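{- For all integers $M,a$, $$\sum_{k=0}^{\infty}\bar C_{M,k}(q)\begin{bmatrix}2k\\ k-a\end{bmatrix}=q^{a^2}\begin{bmatrix}2M\\ M-2a\end{bmatrix},\qquad\text{where } \bar C_{M,k}(q)=\sum_{i=0}^M q^{M(M-i)+k^2}\begin{bmatrix}M\\ i\end{bmatrix}\begin{bmatrix}i\\ 2k\end{bmatrix}\geq 0.$$
   Context: The Gaussian polynomial is $\left[\begin{smallmatrix}m+n\\ m\end{smallmatrix}\right]=\prod_{k=1}^m\frac{1-q^{n+k}}{1-q^k}$ if $m,n\in\{0,1,2,\dots\}$ and $0$ otherwise. For a polynomial $P$, $P\geq 0$ means all its coefficients are nonnegative. -}

module Defs where

open import Data.Nat as ℕ using (ℕ; zero; suc; _%_; _∸_)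
open import Data.Integer as ℤ using (ℤ; +_; -[1+_]; _+_; _*_; _-_)
open import Data.Bool using (if_then_else_)

-- Formal power series in q with integer coefficients:
-- a series is its coefficient function (coefficient of q^d at d).
PS : Set
PS = ℕ → ℤ

0ₚ : PS
0ₚ _ = + 0

1ₚ : PS
1ₚ zero    = + 1
1ₚ (suc _) = + 0

infixl 6 _⊕_ _⊖_
infixl 7 _⊛_

_⊕_ : PS → PS → PS
(f ⊕ g) d = f d + g d

_⊖_ : PS → PS → PS
(f ⊖ g) d = f d - g d

sumℤ : ℕ → (ℕ → ℤ) → ℤ
sumℤ zero    f = f 0
sumℤ (suc n) f = sumℤ n f + f (suc n)

_⊛_ : PS → PS → PS
(f ⊛ g) d = sumℤ d (λ i → f i * g (d ∸ i))

Σₚ[≤_] : ℕ → (ℕ → PS) → PS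
Σₚ[≤ n ] F d = sumℤ n (λ i → F i d)

Πₚ[1…_] : ℕ → (ℕ → PS) → PS
Πₚ[1… zero ]  F = 1ₚ
Πₚ[1… suc m ] F = Πₚ[1… m ] F ⊛ F (suc m)

qpow : ℕ → PS
qpow e d = if d ℕ.≡ᵇ e then + 1 else + 0

-- the geometric series Σ_t q^{t(j+1)} = 1/(1 - q^{j+1}) in ℤ[[q]]
geomInv : ℕ → PS
geomInv j d = if (d % suc j) ℕ.≡ᵇ 0 then + 1 else + 0

-- Gaussian polynomial [m+n over m] for m,n ∈ ℕ, as the element
--   Π_{k=1}^{m} (1 - q^{n+k}) / (1 - q^k)   of ℤ[[q]]
gaussℕ : ℕ → ℕ → PS
gaussℕ m n = Πₚ[1… m ] (λ k → (1ₚ ⊖ qpow (n ℕ.+ k)) ⊛ geomInv (k ∸ 1))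

gaussℤ : ℤ → ℤ → PS
gaussℤ (+ m)     (+ n)     = gaussℕ m n
gaussℤ (+ m)     -[1+ n ]  = 0ₚ
gaussℤ -[1+ m ]  _         = 0ₚ

-- bracket notation  [A over B] = [ (B) + (A - B) over B ]
qbin : ℤ → ℤ → PS
qbin A B = gaussℤ B (A - B)

Cbar : ℤ → ℕ → PS
Cbar (+ M)    k = Σₚ[≤ M ] (λ i →
  qpow (M ℕ.* (M ∸ i) ℕ.+ k ℕ.* k) ⊛ qbin (+ M) (+ i) ⊛ qbin (+ i) (+ (2 ℕ.* k)))
Cbar -[1+ _ ] k = 0ₚ

-- Write M = m and a = α ≥ 0. Two applications of q-Vandermonde ([2m, k] through 2m = m + m, then the
-- second factor [m, k - r] through m = r + (m - r)) turn q^{α²}[2m, m - 2α] into a double sum over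
-- (r, t). Expanding C̄_{m,α+t} as a sum over i = 2(α+t) + c, the c-th summand of C̄_{m,α+t}[2(α+t), t]
-- is q^{α²} times the (r = t + c, t) term of that double sum, as one sees by writing every Gaussian
-- polynomial as a quotient of q-factorials in ℤ[[q]]. Only k with α ≤ k and 2k ≤ m contribute, so the
-- sum is constant from K = α + m on. Negative a reduces to -a by the symmetry [n, j] = [n, n - j],
-- for negative M both sides vanish, and C̄ ≥ 0 follows from the q-Pascal recurrence.
module Submission where

open import Defs
open import Data.Nat as ℕ using (ℕ)
open import Data.Integer as ℤ using (ℤ; +_; _-_; _*_; _≤_; ∣_∣)
open import Data.Product using (_×_; ∃-syntax)
open import Relation.Binary.PropositionalEquality using (_≡_)

open import Data.Nat using (zero; suc; _∸_; z≤n; s≤s)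
import Data.Nat.Properties as ℕP
import Data.Nat.DivMod as ℕ
import Data.Nat.Tactic.RingSolver as ℕ-Solver
open import Data.Integer using (-[1+_]; _+_; -_; +≤+)
import Data.Integer.Properties as ℤP
import Data.Integer.Tactic.RingSolver as ℤ-Solver
open import Data.Bool using (true; false; if_then_else_)
open import Data.Bool.Properties using (T-≡; ¬-not)
open import Data.Maybe using (Maybe; just; nothing)
open import Data.Product using (_,_)
open import Data.Sum using (inj₁; inj₂)
open import Function using (_∘_; Equivalence)
open import Level using (0ℓ)
open import Relation.Nullary using (¬_; yes; no)
open import Relation.Binary.Definitions using (tri<; tri≈; tri>)
open import Relation.Binary.PropositionalEquality using (refl; sym; trans; cong; cong₂; subst; module ≡-Reasoning)
open import Algebra.Bundles using (CommutativeRing)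
import Algebra.Solver.Ring
import Algebra.Solver.Ring.AlmostCommutativeRing as ACR
import Relation.Binary.Reasoning.Setoid

sumℤ-cong : ∀ n {f g : ℕ → ℤ} → (∀ i → i ℕ.≤ n → f i ≡ g i) → sumℤ n f ≡ sumℤ n g
sumℤ-cong zero    f≡g = f≡g 0 z≤n
sumℤ-cong (suc n) f≡g =
  cong₂ _+_ (sumℤ-cong n (λ i i≤n → f≡g i (ℕP.m≤n⇒m≤1+n i≤n))) (f≡g (suc n) ℕP.≤-refl)

sumℤ-zero : ∀ n {f : ℕ → ℤ} → (∀ i → i ℕ.≤ n → f i ≡ + 0) → sumℤ n f ≡ + 0
sumℤ-zero n {f} f≡0 = trans (sumℤ-cong n f≡0) (zeros n)
  where
  zeros : ∀ n → sumℤ n (λ _ → + 0) ≡ + 0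
  zeros zero    = refl
  zeros (suc n) = cong (_+ + 0) (zeros n)

sumℤ-+ : ∀ n (f g : ℕ → ℤ) → sumℤ n (λ i → f i + g i) ≡ sumℤ n f + sumℤ n g
sumℤ-+ zero    f g = refl
sumℤ-+ (suc n) f g =
  trans (cong (_+ (f (suc n) + g (suc n))) (sumℤ-+ n f g))
        (interchange (sumℤ n f) (sumℤ n g) (f (suc n)) (g (suc n)))
  where
  interchange : ∀ a b c d → a + b + (c + d) ≡ a + c + (b + d)
  interchange = ℤ-Solver.solve-∀

sumℤ-*ˡ : ∀ n c (f : ℕ → ℤ) → sumℤ n (λ i → c * f i) ≡ c * sumℤ n f
sumℤ-*ˡ zero    c f = refl
sumℤ-*ˡ (suc n) c f =
  trans (cong (_+ c * f (suc n)) (sumℤ-*ˡ n c f)) (sym (ℤP.*-distribˡ-+ c (sumℤ n f) (f (suc n))))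

sumℤ-*ʳ : ∀ n c (f : ℕ → ℤ) → sumℤ n (λ i → f i * c) ≡ sumℤ n f * c
sumℤ-*ʳ zero    c f = refl
sumℤ-*ʳ (suc n) c f =
  trans (cong (_+ f (suc n) * c) (sumℤ-*ʳ n c f)) (sym (ℤP.*-distribʳ-+ c (sumℤ n f) (f (suc n))))

sumℤ-unconsˡ : ∀ n (f : ℕ → ℤ) → sumℤ (suc n) f ≡ f 0 + sumℤ n (λ i → f (suc i))
sumℤ-unconsˡ zero    f = refl
sumℤ-unconsˡ (suc n) f =
  trans (cong (_+ f (suc (suc n))) (sumℤ-unconsˡ n f))
        (ℤP.+-assoc (f 0) (sumℤ n (λ i → f (suc i))) (f (suc (suc n))))

sumℤ-reverse : ∀ n (f : ℕ → ℤ) → sumℤ n f ≡ sumℤ n (λ i → f (n ∸ i))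
sumℤ-reverse zero    f = refl
sumℤ-reverse (suc n) f = begin
  sumℤ (suc n) f                                    ≡⟨ sumℤ-unconsˡ n f ⟩
  f 0 + sumℤ n (λ i → f (suc i))                    ≡⟨ ℤP.+-comm (f 0) _ ⟩
  sumℤ n (λ i → f (suc i)) + f 0                    ≡⟨ cong₂ _+_ (sumℤ-reverse n (λ i → f (suc i))) (cong f (sym (ℕP.n∸n≡0 n))) ⟩
  sumℤ n (λ i → f (suc (n ∸ i))) + f (n ∸ n)        ≡⟨ cong (_+ f (n ∸ n)) (sumℤ-cong n (λ i i≤n → cong f (sym (ℕP.+-∸-assoc 1 i≤n)))) ⟩
  sumℤ (suc n) (λ i → f (suc n ∸ i))                ∎
  where open ≡-Reasoning

sumℤ-extend : ∀ n N (f : ℕ → ℤ) → n ℕ.≤ N → (∀ i → n ℕ.< i → i ℕ.≤ N → f i ≡ + 0) →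
  sumℤ N f ≡ sumℤ n f
sumℤ-extend n zero    f z≤n   _   = refl
sumℤ-extend n (suc N) f n≤1+N f≡0 with ℕP.m≤n⇒m<n∨m≡n n≤1+N
... | inj₂ refl = refl
... | inj₁ (s≤s n≤N) =
  trans (cong₂ _+_ (sumℤ-extend n N f n≤N (λ i n<i i≤N → f≡0 i n<i (ℕP.m≤n⇒m≤1+n i≤N)))
                   (f≡0 (suc N) (s≤s n≤N) ℕP.≤-refl))
        (ℤP.+-identityʳ (sumℤ n f))

sumℤ-dropˡ : ∀ c n (f : ℕ → ℤ) → (∀ i → i ℕ.< c → f i ≡ + 0) →
  sumℤ (c ℕ.+ n) f ≡ sumℤ n (λ j → f (c ℕ.+ j))
sumℤ-dropˡ zero    n f _   = refl
sumℤ-dropˡ (suc c) n f f≡0 = begin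
  sumℤ (suc (c ℕ.+ n)) f                    ≡⟨ sumℤ-unconsˡ (c ℕ.+ n) f ⟩
  f 0 + sumℤ (c ℕ.+ n) (λ i → f (suc i))    ≡⟨ cong₂ _+_ (f≡0 0 (s≤s z≤n)) (sumℤ-dropˡ c n (λ i → f (suc i)) (λ i i<c → f≡0 (suc i) (s≤s i<c))) ⟩
  + 0 + sumℤ n (λ j → f (suc c ℕ.+ j))      ≡⟨ ℤP.+-identityˡ _ ⟩
  sumℤ n (λ j → f (suc c ℕ.+ j))            ∎
  where open ≡-Reasoning

sumℤ-triangle : ∀ d (φ : ℕ → ℕ → ℤ) →
  sumℤ d (λ s → sumℤ s (λ i → φ i (s ∸ i))) ≡ sumℤ d (λ i → sumℤ (d ∸ i) (φ i))
sumℤ-triangle zero    φ = refl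
sumℤ-triangle (suc d) φ = begin
  sumℤ d (λ s → sumℤ s (λ i → φ i (s ∸ i))) + sumℤ (suc d) (λ i → φ i (suc d ∸ i))
    ≡⟨ cong₂ _+_ (sumℤ-triangle d φ) (cong (λ z → sumℤ d (λ i → φ i (suc d ∸ i)) + φ (suc d) z) (ℕP.n∸n≡0 d)) ⟩
  sumℤ d (λ i → sumℤ (d ∸ i) (φ i)) + (sumℤ d (λ i → φ i (suc d ∸ i)) + φ (suc d) 0)
    ≡⟨ sym (ℤP.+-assoc (sumℤ d (λ i → sumℤ (d ∸ i) (φ i))) (sumℤ d (λ i → φ i (suc d ∸ i))) (φ (suc d) 0)) ⟩
  sumℤ d (λ i → sumℤ (d ∸ i) (φ i)) + sumℤ d (λ i → φ i (suc d ∸ i)) + φ (suc d) 0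
    ≡⟨ cong (_+ φ (suc d) 0) (sym (sumℤ-+ d _ _)) ⟩
  sumℤ d (λ i → sumℤ (d ∸ i) (φ i) + φ i (suc d ∸ i)) + φ (suc d) 0
    ≡⟨ cong₂ _+_ (sumℤ-cong d (λ i i≤d → snoc i (sym (ℕP.+-∸-assoc 1 i≤d))))
                 (cong (λ z → sumℤ z (φ (suc d))) (sym (ℕP.n∸n≡0 d))) ⟩
  sumℤ (suc d) (λ i → sumℤ (suc d ∸ i) (φ i)) ∎
  where
  open ≡-Reasoning
  snoc : ∀ i → suc (d ∸ i) ≡ suc d ∸ i → sumℤ (d ∸ i) (φ i) + φ i (suc d ∸ i) ≡ sumℤ (suc d ∸ i) (φ i)
  snoc i e = trans (cong (λ z → sumℤ (d ∸ i) (φ i) + φ i z) (sym e)) (cong (λ z → sumℤ z (φ i)) e)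

sumℤ-triangle-swap : ∀ k (F : ℕ → ℕ → ℤ) →
  sumℤ k (λ r → sumℤ (k ∸ r) (F r)) ≡ sumℤ k (λ t → sumℤ (k ∸ t) (λ r → F r t))
sumℤ-triangle-swap k F = begin
  sumℤ k (λ r → sumℤ (k ∸ r) (F r))              ≡⟨ sym (sumℤ-triangle k F) ⟩
  sumℤ k (λ s → sumℤ s (λ r → F r (s ∸ r)))      ≡⟨ sumℤ-cong k (λ s _ → trans (sumℤ-reverse s _) (sumℤ-cong s (λ t t≤s → cong (F (s ∸ t)) (ℕP.m∸[m∸n]≡n t≤s)))) ⟩
  sumℤ k (λ s → sumℤ s (λ t → F (s ∸ t) t))      ≡⟨ sumℤ-triangle k (λ t r → F r t) ⟩
  sumℤ k (λ t → sumℤ (k ∸ t) (λ r → F r t))      ∎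
  where open ≡-Reasoning

-- The power-series ring ℤ[[q]]

infix 4 _≈_
-- A record rather than ∀ d → f d ≡ g d, so that unification recovers f and g from f ≈ g.
record _≈_ (f g : PS) : Set where
  constructor mk≈
  field at : ∀ d → f d ≡ g d
open _≈_ public

open import Algebra.Structures {A = PS} _≈_ using (IsCommutativeRing)

≈-reflexive : ∀ {f g} → f ≡ g → f ≈ g
≈-reflexive refl = mk≈ λ _ → refl

⊛-cong : ∀ {f f′ g g′} → f ≈ f′ → g ≈ g′ → f ⊛ g ≈ f′ ⊛ g′
⊛-cong f≈f′ g≈g′ = mk≈ λ d → sumℤ-cong d (λ i _ → cong₂ _*_ (at f≈f′ i) (at g≈g′ (d ∸ i)))

⊛-congʳ : ∀ f {g h} → g ≈ h → f ⊛ g ≈ f ⊛ h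
⊛-congʳ f = ⊛-cong {f} {f} (mk≈ λ _ → refl)

⊛-comm : ∀ f g → f ⊛ g ≈ g ⊛ f
⊛-comm f g = mk≈ λ d → trans (sumℤ-reverse d _) (sumℤ-cong d (λ i i≤d →
  trans (ℤP.*-comm (f (d ∸ i)) (g (d ∸ (d ∸ i)))) (cong (λ j → g j * f (d ∸ i)) (ℕP.m∸[m∸n]≡n i≤d))))

⊛-assoc : ∀ f g h → (f ⊛ g) ⊛ h ≈ f ⊛ (g ⊛ h)
⊛-assoc f g h = mk≈ λ d → begin
  sumℤ d (λ s → sumℤ s (λ i → f i * g (s ∸ i)) * h (d ∸ s))
    ≡⟨ sumℤ-cong d (λ s _ → sym (sumℤ-*ʳ s (h (d ∸ s)) _)) ⟩
  sumℤ d (λ s → sumℤ s (λ i → f i * g (s ∸ i) * h (d ∸ s)))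
    ≡⟨ sumℤ-cong d (λ s _ → sumℤ-cong s (λ i i≤s → cong (λ t → f i * g (s ∸ i) * h (d ∸ t)) (sym (ℕP.m+[n∸m]≡n i≤s)))) ⟩
  sumℤ d (λ s → sumℤ s (λ i → φ d i (s ∸ i)))
    ≡⟨ sumℤ-triangle d (φ d) ⟩
  sumℤ d (λ i → sumℤ (d ∸ i) (φ d i))
    ≡⟨ sumℤ-cong d (λ i _ → trans (sumℤ-cong (d ∸ i) (λ j _ → reassoc d i j)) (sumℤ-*ˡ (d ∸ i) (f i) _)) ⟩
  sumℤ d (λ i → f i * sumℤ (d ∸ i) (λ j → g j * h (d ∸ i ∸ j))) ∎
  where
  open ≡-Reasoning
  φ : ℕ → ℕ → ℕ → ℤ
  φ d i j = f i * g j * h (d ∸ (i ℕ.+ j))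
  reassoc : ∀ d i j → φ d i j ≡ f i * (g j * h (d ∸ i ∸ j))
  reassoc d i j = trans (cong (λ t → f i * g j * h t) (sym (ℕP.∸-+-assoc d i j))) (ℤP.*-assoc (f i) (g j) _)

⊛-identityˡ : ∀ f → 1ₚ ⊛ f ≈ f
⊛-identityˡ f = mk≈ λ where
  zero    → ℤP.*-identityˡ (f 0)
  (suc d) → trans (sumℤ-unconsˡ d _)
              (trans (cong₂ _+_ (ℤP.*-identityˡ (f (suc d))) (sumℤ-zero d (λ i _ → ℤP.*-zeroˡ (f (d ∸ i)))))
                     (ℤP.+-identityʳ _))

⊛-distribˡ-⊕ : ∀ f g h → f ⊛ (g ⊕ h) ≈ f ⊛ g ⊕ f ⊛ h
⊛-distribˡ-⊕ f g h = mk≈ λ d →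
  trans (sumℤ-cong d (λ i _ → ℤP.*-distribˡ-+ (f i) (g (d ∸ i)) (h (d ∸ i)))) (sumℤ-+ d _ _)

-- Sealed copies of ⊕, ⊛ and negation: unification treats f *ₚ g as rigid, whereas f ⊛ g gets
-- η-expanded into its coefficient sums. This is what lets implicit arguments and the ring solver
-- work with power series.
infixl 6 _+ₚ_
infixl 7 _*ₚ_

opaque
  _+ₚ_ : PS → PS → PS
  _+ₚ_ = _⊕_

  _*ₚ_ : PS → PS → PS
  _*ₚ_ = _⊛_

  -ₚ_ : PS → PS
  (-ₚ f) d = - f d

constₚ : ℤ → PS
constₚ c zero    = c
constₚ c (suc _) = + 0

opaque
  unfolding _+ₚ_ _*ₚ_ -ₚ_

  ⊕≈+ₚ : ∀ f g → f ⊕ g ≈ f +ₚ g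
  ⊕≈+ₚ f g = mk≈ λ _ → refl

  ⊛≈*ₚ : ∀ f g → f ⊛ g ≈ f *ₚ g
  ⊛≈*ₚ f g = mk≈ λ _ → refl

  ⊖≈+ₚ-ₚ : ∀ f g → f ⊖ g ≈ f +ₚ -ₚ g
  ⊖≈+ₚ-ₚ f g = mk≈ λ _ → refl

  *ₚ-at : ∀ f g d → (f *ₚ g) d ≡ (f ⊛ g) d
  *ₚ-at f g d = refl

  +ₚ-at : ∀ f g d → (f +ₚ g) d ≡ f d + g d
  +ₚ-at f g d = refl

  -ₚ-at : ∀ f d → (-ₚ f) d ≡ - f d
  -ₚ-at f d = refl

  isCommutativeRing : IsCommutativeRing _+ₚ_ _*ₚ_ -ₚ_ 0ₚ 1ₚ
  isCommutativeRing = record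
    { isRing = record
      { +-isAbelianGroup = record
        { isGroup = record
          { isMonoid = record
            { isSemigroup = record
              { isMagma = record
                { isEquivalence = record
                  { refl  = mk≈ λ _ → refl
                  ; sym   = λ f≈g → mk≈ λ d → sym (at f≈g d)
                  ; trans = ≈-trans }
                ; ∙-cong = λ f≈f′ g≈g′ → mk≈ λ d → cong₂ _+_ (at f≈f′ d) (at g≈g′ d) }
              ; assoc = λ f g h → mk≈ λ d → ℤP.+-assoc (f d) (g d) (h d) }
            ; identity = (λ f → mk≈ λ d → ℤP.+-identityˡ (f d)) , (λ f → mk≈ λ d → ℤP.+-identityʳ (f d)) }
          ; inverse = (λ f → mk≈ λ d → ℤP.+-inverseˡ (f d)) , (λ f → mk≈ λ d → ℤP.+-inverseʳ (f d))
          ; ⁻¹-cong = λ f≈g → mk≈ λ d → cong -_ (at f≈g d) }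
        ; comm = λ f g → mk≈ λ d → ℤP.+-comm (f d) (g d) }
      ; *-cong = ⊛-cong
      ; *-assoc = ⊛-assoc
      ; *-identity = ⊛-identityˡ , λ f → ≈-trans (⊛-comm f 1ₚ) (⊛-identityˡ f)
      ; distrib = ⊛-distribˡ-⊕ , λ f g h → ≈-trans (⊛-comm (g ⊕ h) f) (≈-trans (⊛-distribˡ-⊕ f g h)
                    (mk≈ λ d → cong₂ _+_ (at (⊛-comm f g) d) (at (⊛-comm f h) d))) }
    ; *-comm = ⊛-comm }
    where
    ≈-trans : ∀ {f g h} → f ≈ g → g ≈ h → f ≈ h
    ≈-trans f≈g g≈h = mk≈ λ d → trans (at f≈g d) (at g≈h d)

PowerSeries : CommutativeRing 0ℓ 0ℓ
PowerSeries = record { isCommutativeRing = isCommutativeRing }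

constₚ-homomorphism : ℤ.+-*-rawRing ACR.-Raw-AlmostCommutative⟶ ACR.fromCommutativeRing PowerSeries
constₚ-homomorphism = record
  { ⟦_⟧    = constₚ
  ; +-homo = λ a b → mk≈ λ d → sym (trans (+ₚ-at (constₚ a) (constₚ b) d) (+-at a b d))
  ; *-homo = λ a b → mk≈ λ d → sym (trans (*ₚ-at (constₚ a) (constₚ b) d) (*-at a b d))
  ; -‿homo = λ a → mk≈ λ d → sym (trans (-ₚ-at (constₚ a) d) (neg-at a d))
  ; 0-homo = mk≈ λ where zero → refl ; (suc _) → refl
  ; 1-homo = mk≈ λ where zero → refl ; (suc _) → refl }
  where
  +-at : ∀ a b d → constₚ a d + constₚ b d ≡ constₚ (a + b) d
  +-at a b zero    = refl
  +-at a b (suc d) = refl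
  neg-at : ∀ a d → - constₚ a d ≡ constₚ (- a) d
  neg-at a zero    = refl
  neg-at a (suc d) = refl
  *-at : ∀ a b d → (constₚ a ⊛ constₚ b) d ≡ constₚ (a * b) d
  *-at a b zero    = refl
  *-at a b (suc d) = trans (sumℤ-unconsˡ d _)
    (trans (cong₂ _+_ (ℤP.*-zeroʳ a) (sumℤ-zero d (λ i _ → ℤP.*-zeroˡ (constₚ b (d ∸ i))))) refl)

coeff? : ∀ a b → Maybe (constₚ a ≈ constₚ b)
coeff? a b with a ℤ.≟ b
... | yes a≡b = just (≈-reflexive (cong constₚ a≡b))
... | no _ = nothing

open Algebra.Solver.Ring ℤ.+-*-rawRing (ACR.fromCommutativeRing PowerSeries) constₚ-homomorphism coeff?
  using (solve; _:=_; _:+_; _:*_; _:-_; con)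


open CommutativeRing PowerSeries using (+-cong; *-cong; -‿cong; *-comm; *-identityˡ; *-identityʳ; zeroˡ; zeroʳ; distribˡ)
  renaming (refl to ≈-refl; sym to ≈-sym; trans to ≈-trans; setoid to ≈-setoid)
module ≈-Reasoning = Relation.Binary.Reasoning.Setoid ≈-setoid

1ₚ≈const : 1ₚ ≈ constₚ (+ 1)
1ₚ≈const = mk≈ λ where zero → refl ; (suc _) → refl

0ₚ≈const : 0ₚ ≈ constₚ (+ 0)
0ₚ≈const = mk≈ λ where zero → refl ; (suc _) → refl

*ₚ-zeroʳ : ∀ f {g} → g ≈ 0ₚ → f *ₚ g ≈ 0ₚ
*ₚ-zeroʳ f g≈0 = ≈-trans (*-cong ≈-refl g≈0) (zeroʳ f)

*ₚ-zeroˡ : ∀ {f} g → f ≈ 0ₚ → f *ₚ g ≈ 0ₚ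
*ₚ-zeroˡ g f≈0 = ≈-trans (*-cong f≈0 ≈-refl) (zeroˡ g)

qpow-diag : ∀ e → qpow e e ≡ + 1
qpow-diag e rewrite Equivalence.to T-≡ (ℕP.≡⇒≡ᵇ e e refl) = refl

qpow-off : ∀ {e i} → ¬ i ≡ e → qpow e i ≡ + 0
qpow-off {e} {i} i≢e rewrite ¬-not (i≢e ∘ ℕP.≡ᵇ⇒≡ i e ∘ Equivalence.from T-≡) = refl

qpow-+-cancelˡ : ∀ a {b e} → qpow (a ℕ.+ b) (a ℕ.+ e) ≡ qpow b e
qpow-+-cancelˡ zero    = refl
qpow-+-cancelˡ (suc a) = qpow-+-cancelˡ a

qpow-0 : qpow 0 ≈ 1ₚ
qpow-0 = mk≈ λ where zero → refl ; (suc _) → refl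

qpow-⊛-below : ∀ e f {d} → d ℕ.< e → (qpow e ⊛ f) d ≡ + 0
qpow-⊛-below e f {d} d<e = sumℤ-zero d λ i i≤d →
  trans (cong (_* f (d ∸ i)) (qpow-off (λ i≡e → ℕP.<⇒≱ d<e (subst (ℕ._≤ d) i≡e i≤d)))) (ℤP.*-zeroˡ (f (d ∸ i)))

qpow-⊛-shift : ∀ e f d → (qpow e ⊛ f) (e ℕ.+ d) ≡ f d
qpow-⊛-shift e f d = begin
  sumℤ (e ℕ.+ d) term                     ≡⟨ sumℤ-dropˡ e d term (λ i i<e → vanish (ℕP.<⇒≢ i<e)) ⟩
  sumℤ d (λ j → term (e ℕ.+ j))           ≡⟨ sumℤ-extend 0 d (λ j → term (e ℕ.+ j)) z≤n (λ where (suc j) _ _ → vanish (ℕP.m+1+n≢m e)) ⟩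
  term (e ℕ.+ 0)                          ≡⟨ cong term (ℕP.+-identityʳ e) ⟩
  qpow e e * f (e ℕ.+ d ∸ e)              ≡⟨ cong₂ _*_ (qpow-diag e) (cong f (ℕP.m+n∸m≡n e d)) ⟩
  + 1 * f d                               ≡⟨ ℤP.*-identityˡ (f d) ⟩
  f d                                     ∎
  where
  open ≡-Reasoning
  term : ℕ → ℤ
  term i = qpow e i * f (e ℕ.+ d ∸ i)
  vanish : ∀ {i} → ¬ i ≡ e → term i ≡ + 0
  vanish {i} i≢e = trans (cong (_* f (e ℕ.+ d ∸ i)) (qpow-off i≢e)) (ℤP.*-zeroˡ (f (e ℕ.+ d ∸ i)))

qpow-*ₚ-qpow : ∀ a b → qpow a *ₚ qpow b ≈ qpow (a ℕ.+ b)
qpow-*ₚ-qpow a b = mk≈ λ d → trans (*ₚ-at (qpow a) (qpow b) d) (case d)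
  where
  case : ∀ d → (qpow a ⊛ qpow b) d ≡ qpow (a ℕ.+ b) d
  case d with ℕP.<-≤-connex d a
  ... | inj₁ d<a = trans (qpow-⊛-below a (qpow b) d<a)
                     (sym (qpow-off (λ d≡a+b → ℕP.<⇒≱ d<a (subst (a ℕ.≤_) (sym d≡a+b) (ℕP.m≤m+n a b)))))
  ... | inj₂ a≤d = begin
    (qpow a ⊛ qpow b) d                     ≡⟨ cong (qpow a ⊛ qpow b) (sym a+[d∸a]≡d) ⟩
    (qpow a ⊛ qpow b) (a ℕ.+ (d ∸ a))       ≡⟨ qpow-⊛-shift a (qpow b) (d ∸ a) ⟩
    qpow b (d ∸ a)                          ≡⟨ sym (qpow-+-cancelˡ a) ⟩
    qpow (a ℕ.+ b) (a ℕ.+ (d ∸ a))          ≡⟨ cong (qpow (a ℕ.+ b)) a+[d∸a]≡d ⟩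
    qpow (a ℕ.+ b) d                        ∎
    where
    open ≡-Reasoning
    a+[d∸a]≡d : a ℕ.+ (d ∸ a) ≡ d
    a+[d∸a]≡d = ℕP.m+[n∸m]≡n a≤d

geomInv-below : ∀ j {d} → d ℕ.< suc j → geomInv j d ≡ 1ₚ d
geomInv-below j {d} d<1+j = trans (cong (λ r → if r ℕ.≡ᵇ 0 then + 1 else + 0) (ℕ.m<n⇒m%n≡m d<1+j)) (at-0 d)
  where
  at-0 : ∀ d → (if d ℕ.≡ᵇ 0 then + 1 else + 0) ≡ 1ₚ d
  at-0 zero    = refl
  at-0 (suc _) = refl

geomInv-periodic : ∀ j e → geomInv j (suc j ℕ.+ e) ≡ geomInv j e
geomInv-periodic j e = cong (λ r → if r ℕ.≡ᵇ 0 then + 1 else + 0)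
  (trans (cong (ℕ._% suc j) (ℕP.+-comm (suc j) e)) (ℕ.[m+n]%n≡m%n e (suc j)))

geomInv-recurrence : ∀ j d → (geomInv j ⊖ qpow (suc j) ⊛ geomInv j) d ≡ 1ₚ d
geomInv-recurrence j d with ℕP.<-≤-connex d (suc j)
... | inj₁ d<1+j = trans (cong (λ x → g d - x) (qpow-⊛-below (suc j) g d<1+j))
                        (trans (ℤP.+-identityʳ (g d)) (geomInv-below j d<1+j))
  where g = geomInv j
... | inj₂ 1+j≤d = begin
  g d - (q ⊛ g) d                           ≡⟨ cong (λ i → g i - (q ⊛ g) i) (sym (ℕP.m+[n∸m]≡n 1+j≤d)) ⟩
  g (suc j ℕ.+ e) - (q ⊛ g) (suc j ℕ.+ e)   ≡⟨ cong₂ _-_ (geomInv-periodic j e) (qpow-⊛-shift (suc j) g e) ⟩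
  g e - g e                                 ≡⟨ ℤP.+-inverseʳ (g e) ⟩
  + 0                                       ≡⟨ cong 1ₚ (ℕP.m+[n∸m]≡n 1+j≤d) ⟩
  1ₚ d                                      ∎
  where
  open ≡-Reasoning
  q g : PS
  q = qpow (suc j)
  g = geomInv j
  e : ℕ
  e = d ∸ suc j

geomInv-inverse : ∀ j → (1ₚ ⊖ qpow (suc j)) *ₚ geomInv j ≈ 1ₚ
geomInv-inverse j = begin
  (1ₚ ⊖ q) *ₚ g                   ≈⟨ *-cong (≈-trans (⊖≈+ₚ-ₚ 1ₚ q) (+-cong 1ₚ≈const ≈-refl)) ≈-refl ⟩
  (constₚ (+ 1) +ₚ -ₚ q) *ₚ g     ≈⟨ solve 2 (λ q g → (con (+ 1) :- q) :* g := g :- q :* g) ≈-refl q g ⟩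
  g +ₚ -ₚ (q *ₚ g)                ≈⟨ ≈-sym (≈-trans (⊖≈+ₚ-ₚ g (q ⊛ g)) (+-cong ≈-refl (-‿cong (⊛≈*ₚ q g)))) ⟩
  g ⊖ q ⊛ g                       ≈⟨ mk≈ (geomInv-recurrence j) ⟩
  1ₚ                              ∎
  where
  open ≈-Reasoning
  q g : PS
  q = qpow (suc j)
  g = geomInv j

-- q-factorials and Gaussian polynomials

*ₚ-unitʳ : ∀ f {g} → g ≈ 1ₚ → f *ₚ g ≈ f
*ₚ-unitʳ f g≈1 = ≈-trans (*-cong ≈-refl g≈1) (*-identityʳ f)

Πₚ-suc : ∀ m (F : ℕ → PS) → Πₚ[1… suc m ] F ≈ Πₚ[1… m ] F *ₚ F (suc m)
Πₚ-suc m F = ⊛≈*ₚ (Πₚ[1… m ] F) (F (suc m))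

Πₚ-⊛ : ∀ m (F G : ℕ → PS) → Πₚ[1… m ] (λ k → F k ⊛ G k) ≈ Πₚ[1… m ] F *ₚ Πₚ[1… m ] G
Πₚ-⊛ zero    F G = ≈-sym (*-identityʳ 1ₚ)
Πₚ-⊛ (suc m) F G = begin
  Πₚ[1… suc m ] (λ k → F k ⊛ G k)                            ≈⟨ Πₚ-suc m _ ⟩
  Πₚ[1… m ] (λ k → F k ⊛ G k) *ₚ (F (suc m) ⊛ G (suc m))     ≈⟨ *-cong (Πₚ-⊛ m F G) (⊛≈*ₚ (F (suc m)) (G (suc m))) ⟩
  (ΠF *ₚ ΠG) *ₚ (F (suc m) *ₚ G (suc m))                     ≈⟨ solve 4 (λ a b c d → (a :* b) :* (c :* d) := (a :* c) :* (b :* d)) ≈-refl ΠF ΠG (F (suc m)) (G (suc m)) ⟩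
  (ΠF *ₚ F (suc m)) *ₚ (ΠG *ₚ G (suc m))                     ≈⟨ ≈-sym (*-cong (Πₚ-suc m F) (Πₚ-suc m G)) ⟩
  Πₚ[1… suc m ] F *ₚ Πₚ[1… suc m ] G                         ∎
  where
  open ≈-Reasoning
  ΠF ΠG : PS
  ΠF = Πₚ[1… m ] F
  ΠG = Πₚ[1… m ] G

Πₚ-1 : ∀ m (F : ℕ → PS) → (∀ k → F (suc k) ≈ 1ₚ) → Πₚ[1… m ] F ≈ 1ₚ
Πₚ-1 zero    F F≈1 = ≈-refl
Πₚ-1 (suc m) F F≈1 = ≈-trans (Πₚ-suc m F) (≈-trans (*ₚ-unitʳ _ (F≈1 m)) (Πₚ-1 m F F≈1))

Πₚ-+ : ∀ n m (F : ℕ → PS) → Πₚ[1… m ] (λ k → F (n ℕ.+ k)) *ₚ Πₚ[1… n ] F ≈ Πₚ[1… n ℕ.+ m ] F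
Πₚ-+ n zero    F = ≈-trans (*-comm 1ₚ _) (≈-trans (*-identityʳ _) (≈-reflexive (cong (λ z → Πₚ[1… z ] F) (sym (ℕP.+-identityʳ n)))))
Πₚ-+ n (suc m) F = begin
  Πₚ[1… suc m ] F[n+] *ₚ Πₚ[1… n ] F                ≈⟨ *-cong (Πₚ-suc m F[n+]) ≈-refl ⟩
  Πₚ[1… m ] F[n+] *ₚ F (n ℕ.+ suc m) *ₚ Πₚ[1… n ] F ≈⟨ solve 3 (λ a b c → a :* b :* c := a :* c :* b) ≈-refl _ _ _ ⟩
  Πₚ[1… m ] F[n+] *ₚ Πₚ[1… n ] F *ₚ F (n ℕ.+ suc m) ≈⟨ *-cong (Πₚ-+ n m F) ≈-refl ⟩
  Πₚ[1… n ℕ.+ m ] F *ₚ F (n ℕ.+ suc m)              ≈⟨ ≈-reflexive (cong (λ z → Πₚ[1… n ℕ.+ m ] F *ₚ F z) (ℕP.+-suc n m)) ⟩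
  Πₚ[1… n ℕ.+ m ] F *ₚ F (suc (n ℕ.+ m))            ≈⟨ ≈-sym (Πₚ-suc (n ℕ.+ m) F) ⟩
  Πₚ[1… suc (n ℕ.+ m) ] F                           ≈⟨ ≈-reflexive (cong (λ z → Πₚ[1… z ] F) (sym (ℕP.+-suc n m))) ⟩
  Πₚ[1… n ℕ.+ suc m ] F                             ∎
  where
  open ≈-Reasoning
  F[n+] : ℕ → PS
  F[n+] k = F (n ℕ.+ k)

qfac : ℕ → PS
qfac n = Πₚ[1… n ] (λ k → 1ₚ ⊖ qpow k)

qfacInv : ℕ → PS
qfacInv n = Πₚ[1… n ] (λ k → geomInv (k ∸ 1))

qfac-inverse : ∀ n → qfac n *ₚ qfacInv n ≈ 1ₚ
qfac-inverse n = ≈-trans (≈-sym (Πₚ-⊛ n _ _))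
  (Πₚ-1 n _ (λ k → ≈-trans (⊛≈*ₚ (1ₚ ⊖ qpow (suc k)) (geomInv k)) (geomInv-inverse k)))

gaussℕ-qfac : ∀ m n → gaussℕ m n ≈ qfac (n ℕ.+ m) *ₚ qfacInv m *ₚ qfacInv n
gaussℕ-qfac m n = begin
  gaussℕ m n                                            ≈⟨ Πₚ-⊛ m (λ k → 1ₚ ⊖ qpow (n ℕ.+ k)) (λ k → geomInv (k ∸ 1)) ⟩
  X *ₚ qfacInv m                                        ≈⟨ ≈-sym (*ₚ-unitʳ _ (qfac-inverse n)) ⟩
  X *ₚ qfacInv m *ₚ (qfac n *ₚ qfacInv n)               ≈⟨ solve 4 (λ x i f j → x :* i :* (f :* j) := x :* f :* i :* j) ≈-refl X (qfacInv m) (qfac n) (qfacInv n) ⟩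
  X *ₚ qfac n *ₚ qfacInv m *ₚ qfacInv n                 ≈⟨ *-cong (*-cong (Πₚ-+ n m (λ k → 1ₚ ⊖ qpow k)) ≈-refl) ≈-refl ⟩
  qfac (n ℕ.+ m) *ₚ qfacInv m *ₚ qfacInv n              ∎
  where
  open ≈-Reasoning
  X : PS
  X = Πₚ[1… m ] (λ k → 1ₚ ⊖ qpow (n ℕ.+ k))

qfacInv-suc : ∀ k → qfacInv k ≈ (1ₚ ⊖ qpow (suc k)) *ₚ qfacInv (suc k)
qfacInv-suc k = begin
  qfacInv k                                             ≈⟨ ≈-sym (*ₚ-unitʳ _ (geomInv-inverse k)) ⟩
  qfacInv k *ₚ ((1ₚ ⊖ qpow (suc k)) *ₚ geomInv k)      ≈⟨ solve 3 (λ i a g → i :* (a :* g) := a :* (i :* g)) ≈-refl _ _ _ ⟩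
  (1ₚ ⊖ qpow (suc k)) *ₚ (qfacInv k *ₚ geomInv k)      ≈⟨ *-cong ≈-refl (≈-sym (Πₚ-suc k _)) ⟩
  (1ₚ ⊖ qpow (suc k)) *ₚ qfacInv (suc k)               ∎
  where open ≈-Reasoning

gaussℕ-sym : ∀ m n → gaussℕ m n ≈ gaussℕ n m
gaussℕ-sym m n = begin
  gaussℕ m n                                    ≈⟨ gaussℕ-qfac m n ⟩
  qfac (n ℕ.+ m) *ₚ qfacInv m *ₚ qfacInv n      ≈⟨ ≈-reflexive (cong (λ z → qfac z *ₚ qfacInv m *ₚ qfacInv n) (ℕP.+-comm n m)) ⟩
  qfac (m ℕ.+ n) *ₚ qfacInv m *ₚ qfacInv n      ≈⟨ solve 3 (λ a b c → a :* b :* c := a :* c :* b) ≈-refl _ _ _ ⟩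
  qfac (m ℕ.+ n) *ₚ qfacInv n *ₚ qfacInv m      ≈⟨ ≈-sym (gaussℕ-qfac n m) ⟩
  gaussℕ n m                                    ∎
  where open ≈-Reasoning

gaussℕ-pascal : ∀ m n → gaussℕ (suc m) (suc n) ≈ gaussℕ m (suc n) +ₚ qpow (suc m) *ₚ gaussℕ (suc m) n
gaussℕ-pascal m n = begin
  gaussℕ (suc m) (suc n)
    ≈⟨ gaussℕ-qfac (suc m) (suc n) ⟩
  qfac (suc n ℕ.+ suc m) *ₚ X *ₚ Y
    ≈⟨ *-cong (*-cong (≈-trans (≈-reflexive (cong (qfac ∘ suc) (ℕP.+-suc n m))) (Πₚ-suc (suc (n ℕ.+ m)) _)) ≈-refl) ≈-refl ⟩
  A *ₚ (1ₚ ⊖ qpow (suc (suc (n ℕ.+ m)))) *ₚ X *ₚ Y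
    ≈⟨ *-cong (*-cong (*-cong ≈-refl (≈-trans (⊖≈+ₚ-ₚ _ _) (+-cong 1ₚ≈const (-‿cong (≈-sym P*Q))))) ≈-refl) ≈-refl ⟩
  A *ₚ (constₚ (+ 1) +ₚ -ₚ (P *ₚ Q)) *ₚ X *ₚ Y
    ≈⟨ solve 5 (λ a p q x y → a :* (con (+ 1) :- p :* q) :* x :* y :=
                  a :* ((con (+ 1) :- p) :* x) :* y :+ p :* (a :* x :* ((con (+ 1) :- q) :* y))) ≈-refl A P Q X Y ⟩
  A *ₚ ((constₚ (+ 1) +ₚ -ₚ P) *ₚ X) *ₚ Y +ₚ P *ₚ (A *ₚ X *ₚ ((constₚ (+ 1) +ₚ -ₚ Q) *ₚ Y))
    ≈⟨ +-cong (*-cong (*-cong ≈-refl (≈-trans (*-cong (1-q P) ≈-refl) (≈-sym (qfacInv-suc m)))) ≈-refl)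
              (*-cong ≈-refl (*-cong ≈-refl (≈-trans (*-cong (1-q Q) ≈-refl) (≈-sym (qfacInv-suc n))))) ⟩
  A *ₚ qfacInv m *ₚ Y +ₚ P *ₚ (A *ₚ X *ₚ qfacInv n)
    ≈⟨ +-cong (≈-sym (gaussℕ-qfac m (suc n)))
              (*-cong ≈-refl (≈-trans (≈-reflexive (cong (λ z → qfac z *ₚ X *ₚ qfacInv n) (sym (ℕP.+-suc n m)))) (≈-sym (gaussℕ-qfac (suc m) n)))) ⟩
  gaussℕ m (suc n) +ₚ qpow (suc m) *ₚ gaussℕ (suc m) n
    ∎
  where
  open ≈-Reasoning
  A X Y P Q : PS
  A = qfac (suc (n ℕ.+ m))
  X = qfacInv (suc m)
  Y = qfacInv (suc n)
  P = qpow (suc m)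
  Q = qpow (suc n)
  P*Q : P *ₚ Q ≈ qpow (suc (suc (n ℕ.+ m)))
  P*Q = ≈-trans (qpow-*ₚ-qpow (suc m) (suc n))
                (≈-reflexive (cong (qpow ∘ suc) (trans (ℕP.+-suc m n) (cong suc (ℕP.+-comm m n)))))
  1-q : ∀ f → constₚ (+ 1) +ₚ -ₚ f ≈ 1ₚ ⊖ f
  1-q f = ≈-sym (≈-trans (⊖≈+ₚ-ₚ 1ₚ f) (+-cong 1ₚ≈const ≈-refl))

gaussℤ-sym : ∀ x y → gaussℤ x y ≈ gaussℤ y x
gaussℤ-sym (+ m)    (+ n)    = gaussℕ-sym m n
gaussℤ-sym (+ _)    -[1+ _ ] = ≈-refl
gaussℤ-sym -[1+ _ ] (+ _)    = ≈-refl
gaussℤ-sym -[1+ _ ] -[1+ _ ] = ≈-refl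

gaussℤ-negative : ∀ x y {n} → x + y ≡ -[1+ n ] → gaussℤ x y ≈ 0ₚ
gaussℤ-negative (+ _)    (+ _)    ()
gaussℤ-negative (+ _)    -[1+ _ ] _ = ≈-refl
gaussℤ-negative -[1+ _ ] _        _ = ≈-refl

qbin-reflect : ∀ A B → qbin A B ≈ qbin A (A - B)
qbin-reflect A B = ≈-trans (gaussℤ-sym B (A - B)) (≈-reflexive (cong (gaussℤ (A - B)) (sym (reflect A B))))
  where
  reflect : ∀ A B → A - (A - B) ≡ B
  reflect = ℤ-Solver.solve-∀

NonNeg : PS → Set
NonNeg f = ∀ d → + 0 ≤ f d

nonNeg-+ : ∀ {a b} → + 0 ≤ a → + 0 ≤ b → + 0 ≤ a + b
nonNeg-+ {+ _} {+ _} _ _ = +≤+ z≤n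

nonNeg-* : ∀ {a b} → + 0 ≤ a → + 0 ≤ b → + 0 ≤ a * b
nonNeg-* {+ x} {+ y} _ _ = subst (+ 0 ≤_) (ℤP.pos-* x y) (+≤+ z≤n)

nonNeg-sumℤ : ∀ n {f : ℕ → ℤ} → (∀ i → + 0 ≤ f i) → + 0 ≤ sumℤ n f
nonNeg-sumℤ zero    f≥0 = f≥0 0
nonNeg-sumℤ (suc n) f≥0 = nonNeg-+ (nonNeg-sumℤ n f≥0) (f≥0 (suc n))

nonNeg-≈ : ∀ {f g} → f ≈ g → NonNeg f → NonNeg g
nonNeg-≈ f≈g f≥0 d = subst (+ 0 ≤_) (at f≈g d) (f≥0 d)

nonNeg-⊕ : ∀ {f g} → NonNeg f → NonNeg g → NonNeg (f ⊕ g)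
nonNeg-⊕ f≥0 g≥0 d = nonNeg-+ (f≥0 d) (g≥0 d)

nonNeg-⊛ : ∀ {f g} → NonNeg f → NonNeg g → NonNeg (f ⊛ g)
nonNeg-⊛ f≥0 g≥0 d = nonNeg-sumℤ d (λ i → nonNeg-* (f≥0 i) (g≥0 (d ∸ i)))

nonNeg-Σₚ : ∀ n {F} → (∀ i → NonNeg (F i)) → NonNeg (Σₚ[≤ n ] F)
nonNeg-Σₚ n F≥0 d = nonNeg-sumℤ n (λ i → F≥0 i d)

nonNeg-0ₚ : NonNeg 0ₚ
nonNeg-0ₚ _ = +≤+ z≤n

nonNeg-1ₚ : NonNeg 1ₚ
nonNeg-1ₚ zero    = +≤+ z≤n
nonNeg-1ₚ (suc _) = +≤+ z≤n

nonNeg-qpow : ∀ e → NonNeg (qpow e)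
nonNeg-qpow e d with d ℕ.≡ᵇ e
... | true  = +≤+ z≤n
... | false = +≤+ z≤n

nonNeg-gaussℕ : ∀ m n → NonNeg (gaussℕ m n)
nonNeg-gaussℕ zero    n       = nonNeg-1ₚ
nonNeg-gaussℕ (suc m) zero    = nonNeg-≈ (gaussℕ-sym zero (suc m)) nonNeg-1ₚ
nonNeg-gaussℕ (suc m) (suc n) =
  nonNeg-≈ (≈-sym (≈-trans (gaussℕ-pascal m n) (≈-sym (≈-trans (⊕≈+ₚ _ _) (+-cong ≈-refl (⊛≈*ₚ _ _))))))
    (nonNeg-⊕ (nonNeg-gaussℕ m (suc n)) (nonNeg-⊛ (nonNeg-qpow (suc m)) (nonNeg-gaussℕ (suc m) n)))

nonNeg-qbin : ∀ A B → NonNeg (qbin A B)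
nonNeg-qbin A B = nonNeg-gaussℤ B (A - B)
  where
  nonNeg-gaussℤ : ∀ x y → NonNeg (gaussℤ x y)
  nonNeg-gaussℤ (+ m)    (+ n)    = nonNeg-gaussℕ m n
  nonNeg-gaussℤ (+ _)    -[1+ _ ] = nonNeg-0ₚ
  nonNeg-gaussℤ -[1+ _ ] _        = nonNeg-0ₚ

nonNeg-Cbar : ∀ M k → NonNeg (Cbar M k)
nonNeg-Cbar (+ M)    k = nonNeg-Σₚ M λ i →
  nonNeg-⊛ (nonNeg-⊛ (nonNeg-qpow (M ℕ.* (M ∸ i) ℕ.+ k ℕ.* k)) (nonNeg-qbin (+ M) (+ i))) (nonNeg-qbin (+ i) (+ (2 ℕ.* k)))
nonNeg-Cbar -[1+ _ ] k = nonNeg-0ₚ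

-- q-Vandermonde

qbinℕ : ℕ → ℕ → PS
qbinℕ N K = qbin (+ N) (+ K)

pos-+-minus : ∀ a b → + (a ℕ.+ b) - + a ≡ + b
pos-+-minus a b = trans (cong (_- + a) (ℤP.pos-+ a b)) (cancel (+ a) (+ b))
  where
  cancel : ∀ x y → x + y - x ≡ y
  cancel = ℤ-Solver.solve-∀

pos-minus-larger : ∀ n r → + n - + (suc n ℕ.+ r) ≡ -[1+ r ]
pos-minus-larger n r = trans (cong (λ z → + n - z) (trans (cong +_ (sym (ℕP.+-suc n r))) (ℤP.pos-+ n (suc r))))
                             (cancel (+ n) (+ suc r))
  where
  cancel : ∀ x y → x - (x + y) ≡ - y
  cancel = ℤ-Solver.solve-∀

qbinℕ-+ : ∀ x y → qbinℕ (x ℕ.+ y) x ≡ gaussℕ x y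
qbinℕ-+ x y = cong (gaussℤ (+ x)) (pos-+-minus x y)

qbinℕ-> : ∀ {N K} → N ℕ.< K → qbinℕ N K ≈ 0ₚ
qbinℕ-> {N} N<K with ℕP.m≤n⇒∃[o]m+o≡n N<K
... | r , refl = ≈-reflexive (cong (gaussℤ (+ (suc N ℕ.+ r))) (pos-minus-larger N r))

qbinℕ-diag : ∀ N → qbinℕ N N ≈ 1ₚ
qbinℕ-diag N = ≈-trans (≈-reflexive (trans (cong (λ z → qbinℕ z N) (sym (ℕP.+-identityʳ N))) (qbinℕ-+ N 0)))
                       (gaussℕ-sym N 0)

qbinℕ-pascal : ∀ N K → qbinℕ (suc N) (suc K) ≈ qbinℕ N K +ₚ qpow (suc K) *ₚ qbinℕ N (suc K)
qbinℕ-pascal N K with ℕP.<-cmp K N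
... | tri< K<N _ _ with ℕP.m≤n⇒∃[o]m+o≡n K<N
...   | n , refl = begin
  qbinℕ (suc (suc K ℕ.+ n)) (suc K)                      ≈⟨ ≈-reflexive (cong (λ z → qbinℕ z (suc K)) (sym (ℕP.+-suc (suc K) n))) ⟩
  qbinℕ (suc K ℕ.+ suc n) (suc K)                        ≈⟨ ≈-reflexive (qbinℕ-+ (suc K) (suc n)) ⟩
  gaussℕ (suc K) (suc n)                                 ≈⟨ gaussℕ-pascal K n ⟩
  gaussℕ K (suc n) +ₚ qpow (suc K) *ₚ gaussℕ (suc K) n  ≈⟨ +-cong (≈-reflexive (sym (qbinℕ-+ K (suc n))))
                                                                   (*-cong ≈-refl (≈-reflexive (sym (qbinℕ-+ (suc K) n)))) ⟩
  qbinℕ (K ℕ.+ suc n) K +ₚ qpow (suc K) *ₚ qbinℕ (suc K ℕ.+ n) (suc K)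
                                                         ≈⟨ +-cong (≈-reflexive (cong (λ z → qbinℕ z K) (ℕP.+-suc K n))) ≈-refl ⟩
  qbinℕ (suc K ℕ.+ n) K +ₚ qpow (suc K) *ₚ qbinℕ (suc K ℕ.+ n) (suc K) ∎
  where open ≈-Reasoning
qbinℕ-pascal N K | tri≈ _ refl _ = begin
  qbinℕ (suc K) (suc K)                                  ≈⟨ ≈-trans (qbinℕ-diag (suc K)) 1ₚ≈const ⟩
  constₚ (+ 1)                                           ≈⟨ solve 1 (λ q → con (+ 1) := con (+ 1) :+ q :* con (+ 0)) ≈-refl (qpow (suc K)) ⟩
  constₚ (+ 1) +ₚ qpow (suc K) *ₚ constₚ (+ 0)           ≈⟨ ≈-sym (+-cong (≈-trans (qbinℕ-diag K) 1ₚ≈const)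
                                                                          (*-cong ≈-refl (≈-trans (qbinℕ-> (ℕP.n<1+n K)) 0ₚ≈const))) ⟩
  qbinℕ K K +ₚ qpow (suc K) *ₚ qbinℕ K (suc K)           ∎
  where open ≈-Reasoning
qbinℕ-pascal N K | tri> _ _ N<K = begin
  qbinℕ (suc N) (suc K)                                  ≈⟨ ≈-trans (qbinℕ-> (s≤s N<K)) 0ₚ≈const ⟩
  constₚ (+ 0)                                           ≈⟨ solve 1 (λ q → con (+ 0) := con (+ 0) :+ q :* con (+ 0)) ≈-refl (qpow (suc K)) ⟩
  constₚ (+ 0) +ₚ qpow (suc K) *ₚ constₚ (+ 0)           ≈⟨ ≈-sym (+-cong (≈-trans (qbinℕ-> N<K) 0ₚ≈const)
                                                                          (*-cong ≈-refl (≈-trans (qbinℕ-> (ℕP.m<n⇒m<1+n N<K)) 0ₚ≈const))) ⟩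
  qbinℕ N K +ₚ qpow (suc K) *ₚ qbinℕ N (suc K)           ∎
  where open ≈-Reasoning

Σₚ-suc : ∀ n F → Σₚ[≤ suc n ] F ≈ Σₚ[≤ n ] F +ₚ F (suc n)
Σₚ-suc n F = ⊕≈+ₚ (Σₚ[≤ n ] F) (F (suc n))

Σₚ-cong : ∀ n {F G} → (∀ i → i ℕ.≤ n → F i ≈ G i) → Σₚ[≤ n ] F ≈ Σₚ[≤ n ] G
Σₚ-cong n F≈G = mk≈ λ d → sumℤ-cong n (λ i i≤n → at (F≈G i i≤n) d)

Σₚ-zero : ∀ n {F} → (∀ i → i ℕ.≤ n → F i ≈ 0ₚ) → Σₚ[≤ n ] F ≈ 0ₚ
Σₚ-zero n F≈0 = mk≈ λ d → sumℤ-zero n (λ i i≤n → at (F≈0 i i≤n) d)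

Σₚ-extend : ∀ n N F → n ℕ.≤ N → (∀ i → n ℕ.< i → i ℕ.≤ N → F i ≈ 0ₚ) → Σₚ[≤ N ] F ≈ Σₚ[≤ n ] F
Σₚ-extend n N F n≤N F≈0 = mk≈ λ d → sumℤ-extend n N (λ i → F i d) n≤N (λ i n<i i≤N → at (F≈0 i n<i i≤N) d)

Σₚ-dropˡ : ∀ c n F → (∀ i → i ℕ.< c → F i ≈ 0ₚ) → Σₚ[≤ c ℕ.+ n ] F ≈ Σₚ[≤ n ] (λ j → F (c ℕ.+ j))
Σₚ-dropˡ c n F F≈0 = mk≈ λ d → sumℤ-dropˡ c n (λ i → F i d) (λ i i<c → at (F≈0 i i<c) d)

Σₚ-unconsˡ : ∀ n F → Σₚ[≤ suc n ] F ≈ F 0 +ₚ Σₚ[≤ n ] (λ i → F (suc i))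
Σₚ-unconsˡ n F = mk≈ λ d → trans (sumℤ-unconsˡ n (λ i → F i d)) (sym (+ₚ-at (F 0) _ d))

Σₚ-+ₚ : ∀ n F G → Σₚ[≤ n ] (λ i → F i +ₚ G i) ≈ Σₚ[≤ n ] F +ₚ Σₚ[≤ n ] G
Σₚ-+ₚ n F G = mk≈ λ d →
  trans (sumℤ-cong n (λ i _ → +ₚ-at (F i) (G i) d))
        (trans (sumℤ-+ n (λ i → F i d) (λ i → G i d)) (sym (+ₚ-at (Σₚ[≤ n ] F) (Σₚ[≤ n ] G) d)))

Σₚ-*ₚˡ : ∀ n f F → f *ₚ Σₚ[≤ n ] F ≈ Σₚ[≤ n ] (λ i → f *ₚ F i)
Σₚ-*ₚˡ zero    f F = ≈-refl
Σₚ-*ₚˡ (suc n) f F = begin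
  f *ₚ Σₚ[≤ suc n ] F                              ≈⟨ *-cong ≈-refl (Σₚ-suc n F) ⟩
  f *ₚ (Σₚ[≤ n ] F +ₚ F (suc n))                   ≈⟨ distribˡ f _ _ ⟩
  f *ₚ Σₚ[≤ n ] F +ₚ f *ₚ F (suc n)                ≈⟨ +-cong (Σₚ-*ₚˡ n f F) ≈-refl ⟩
  Σₚ[≤ n ] (λ i → f *ₚ F i) +ₚ f *ₚ F (suc n)      ≈⟨ ≈-sym (Σₚ-suc n _) ⟩
  Σₚ[≤ suc n ] (λ i → f *ₚ F i)                    ∎
  where open ≈-Reasoning

Σₚ-*ₚʳ : ∀ n f F → Σₚ[≤ n ] F *ₚ f ≈ Σₚ[≤ n ] (λ i → F i *ₚ f)
Σₚ-*ₚʳ n f F = ≈-trans (*-comm _ f) (≈-trans (Σₚ-*ₚˡ n f F) (Σₚ-cong n (λ i _ → *-comm f (F i))))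

Σₚ-triangle-swap : ∀ k (F : ℕ → ℕ → PS) →
  Σₚ[≤ k ] (λ r → Σₚ[≤ k ∸ r ] (F r)) ≈ Σₚ[≤ k ] (λ t → Σₚ[≤ k ∸ t ] (λ r → F r t))
Σₚ-triangle-swap k F = mk≈ λ d → sumℤ-triangle-swap k (λ r t → F r t d)

vandermondeTerm : ℕ → ℕ → ℕ → ℕ → PS
vandermondeTerm m n k j = qpow ((m ∸ j) ℕ.* (k ∸ j)) *ₚ qbinℕ m j *ₚ qbinℕ n (k ∸ j)

vandermonde-exponent : ∀ {m k j} → j ℕ.≤ k → suc j ℕ.≤ m →
  (m ∸ j) ℕ.* (k ∸ j) ℕ.+ suc j ≡ suc k ℕ.+ (m ∸ suc j) ℕ.* (k ∸ j)
vandermonde-exponent {j = j} j≤k j<m with ℕP.m≤n⇒∃[o]m+o≡n j≤k | ℕP.m≤n⇒∃[o]m+o≡n j<m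
... | v , refl | u , refl = begin
  (suc j ℕ.+ u ∸ j) ℕ.* (j ℕ.+ v ∸ j) ℕ.+ suc j
    ≡⟨ cong₂ (λ x y → x ℕ.* y ℕ.+ suc j) (trans (cong (_∸ j) (sym (ℕP.+-suc j u))) (ℕP.m+n∸m≡n j (suc u))) (ℕP.m+n∸m≡n j v) ⟩
  suc u ℕ.* v ℕ.+ suc j
    ≡⟨ identity j u v ⟩
  suc (j ℕ.+ v) ℕ.+ u ℕ.* v
    ≡⟨ cong₂ (λ x y → suc (j ℕ.+ v) ℕ.+ x ℕ.* y) (sym (ℕP.m+n∸m≡n (suc j) u)) (sym (ℕP.m+n∸m≡n j v)) ⟩
  suc (j ℕ.+ v) ℕ.+ (suc j ℕ.+ u ∸ suc j) ℕ.* (j ℕ.+ v ∸ j) ∎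
  where
  open ≡-Reasoning
  identity : ∀ j u v → suc u ℕ.* v ℕ.+ suc j ≡ suc (j ℕ.+ v) ℕ.+ u ℕ.* v
  identity = ℕ-Solver.solve-∀

vandermondeTerm-suc₀ : ∀ m n k → vandermondeTerm (suc m) n (suc k) 0 ≈ qpow (suc k) *ₚ vandermondeTerm m n (suc k) 0
vandermondeTerm-suc₀ m n k = begin
  qpow (suc k ℕ.+ m ℕ.* suc k) *ₚ 1ₚ *ₚ Y                ≈⟨ *-cong (*-cong (≈-sym (qpow-*ₚ-qpow (suc k) (m ℕ.* suc k))) ≈-refl) ≈-refl ⟩
  qpow (suc k) *ₚ qpow (m ℕ.* suc k) *ₚ 1ₚ *ₚ Y          ≈⟨ solve 4 (λ a b c d → a :* b :* c :* d := a :* (b :* c :* d)) ≈-refl _ _ _ _ ⟩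
  qpow (suc k) *ₚ (qpow (m ℕ.* suc k) *ₚ 1ₚ *ₚ Y)        ∎
  where
  open ≈-Reasoning
  Y : PS
  Y = qbinℕ n (suc k)

vandermondeTerm-suc : ∀ m n {k j} → j ℕ.≤ k →
  vandermondeTerm (suc m) n (suc k) (suc j) ≈ vandermondeTerm m n k j +ₚ qpow (suc k) *ₚ vandermondeTerm m n (suc k) (suc j)
vandermondeTerm-suc m n {k} {j} j≤k = begin
  qpow e₁ *ₚ qbinℕ (suc m) (suc j) *ₚ Y
    ≈⟨ *-cong (*-cong ≈-refl (qbinℕ-pascal m j)) ≈-refl ⟩
  qpow e₁ *ₚ (qbinℕ m j +ₚ qpow (suc j) *ₚ qbinℕ m (suc j)) *ₚ Y
    ≈⟨ solve 5 (λ e a p b y → e :* (a :+ p :* b) :* y := e :* a :* y :+ (e :* p :* b) :* y) ≈-refl _ _ _ _ _ ⟩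
  vandermondeTerm m n k j +ₚ qpow e₁ *ₚ qpow (suc j) *ₚ qbinℕ m (suc j) *ₚ Y
    ≈⟨ +-cong ≈-refl (*-cong shift ≈-refl) ⟩
  vandermondeTerm m n k j +ₚ qpow (suc k) *ₚ qpow e₂ *ₚ qbinℕ m (suc j) *ₚ Y
    ≈⟨ +-cong ≈-refl (solve 4 (λ a b c d → a :* b :* c :* d := a :* (b :* c :* d)) ≈-refl _ _ _ _) ⟩
  vandermondeTerm m n k j +ₚ qpow (suc k) *ₚ vandermondeTerm m n (suc k) (suc j) ∎
  where
  open ≈-Reasoning
  e₁ e₂ : ℕ
  e₁ = (m ∸ j) ℕ.* (k ∸ j)
  e₂ = (m ∸ suc j) ℕ.* (k ∸ j)
  Y : PS
  Y = qbinℕ n (k ∸ j)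
  shift : qpow e₁ *ₚ qpow (suc j) *ₚ qbinℕ m (suc j) ≈ qpow (suc k) *ₚ qpow e₂ *ₚ qbinℕ m (suc j)
  shift with ℕP.<-≤-connex m (suc j)
  ... | inj₁ m<1+j = ≈-trans (*ₚ-zeroʳ _ (qbinℕ-> m<1+j)) (≈-sym (*ₚ-zeroʳ _ (qbinℕ-> m<1+j)))
  ... | inj₂ 1+j≤m = *-cong (≈-trans (qpow-*ₚ-qpow e₁ (suc j))
                              (≈-trans (≈-reflexive (cong qpow (vandermonde-exponent j≤k 1+j≤m)))
                                       (≈-sym (qpow-*ₚ-qpow (suc k) e₂)))) ≈-refl

qbinℕ-vandermonde : ∀ m n k → qbinℕ (m ℕ.+ n) k ≈ Σₚ[≤ k ] (vandermondeTerm m n k)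
qbinℕ-vandermonde zero n k = ≈-sym (begin
  Σₚ[≤ k ] (vandermondeTerm 0 n k)   ≈⟨ Σₚ-extend 0 k _ z≤n (λ where (suc j) _ _ → *ₚ-zeroˡ _ (*ₚ-zeroʳ _ (qbinℕ-> {K = suc j} (s≤s z≤n)))) ⟩
  qpow 0 *ₚ 1ₚ *ₚ qbinℕ n k          ≈⟨ *-cong (*-identityʳ _) ≈-refl ⟩
  qpow 0 *ₚ qbinℕ n k                ≈⟨ *-cong qpow-0 ≈-refl ⟩
  1ₚ *ₚ qbinℕ n k                    ≈⟨ *-identityˡ _ ⟩
  qbinℕ n k                          ∎)
  where open ≈-Reasoning
qbinℕ-vandermonde (suc m) n zero = begin
  1ₚ                                           ≈⟨ ≈-sym (≈-trans (*-identityʳ _) (*-identityʳ _)) ⟩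
  1ₚ *ₚ 1ₚ *ₚ 1ₚ                               ≈⟨ *-cong (*-cong (≈-sym (≈-trans (≈-reflexive (cong qpow (ℕP.*-zeroʳ (suc m)))) qpow-0)) ≈-refl) ≈-refl ⟩
  vandermondeTerm (suc m) n 0 0                ∎
  where open ≈-Reasoning
qbinℕ-vandermonde (suc m) n (suc k) = begin
  qbinℕ (suc (m ℕ.+ n)) (suc k)
    ≈⟨ qbinℕ-pascal (m ℕ.+ n) k ⟩
  qbinℕ (m ℕ.+ n) k +ₚ Q *ₚ qbinℕ (m ℕ.+ n) (suc k)
    ≈⟨ +-cong (qbinℕ-vandermonde m n k) (*-cong ≈-refl (≈-trans (qbinℕ-vandermonde m n (suc k)) (Σₚ-unconsˡ k _))) ⟩
  Σₚ[≤ k ] (V m k) +ₚ Q *ₚ (V m (suc k) 0 +ₚ Σₚ[≤ k ] (λ j → V m (suc k) (suc j)))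
    ≈⟨ +-cong ≈-refl (≈-trans (distribˡ Q _ _) (+-cong ≈-refl (Σₚ-*ₚˡ k Q _))) ⟩
  Σₚ[≤ k ] (V m k) +ₚ (Q *ₚ V m (suc k) 0 +ₚ Σₚ[≤ k ] (λ j → Q *ₚ V m (suc k) (suc j)))
    ≈⟨ solve 3 (λ a t b → a :+ (t :+ b) := t :+ (a :+ b)) ≈-refl _ _ _ ⟩
  Q *ₚ V m (suc k) 0 +ₚ (Σₚ[≤ k ] (V m k) +ₚ Σₚ[≤ k ] (λ j → Q *ₚ V m (suc k) (suc j)))
    ≈⟨ +-cong (≈-sym (vandermondeTerm-suc₀ m n k)) (≈-sym (Σₚ-+ₚ k _ _)) ⟩
  V (suc m) (suc k) 0 +ₚ Σₚ[≤ k ] (λ j → V m k j +ₚ Q *ₚ V m (suc k) (suc j))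
    ≈⟨ +-cong ≈-refl (Σₚ-cong k (λ j j≤k → ≈-sym (vandermondeTerm-suc m n j≤k))) ⟩
  V (suc m) (suc k) 0 +ₚ Σₚ[≤ k ] (λ j → V (suc m) (suc k) (suc j))
    ≈⟨ ≈-sym (Σₚ-unconsˡ k _) ⟩
  Σₚ[≤ suc k ] (V (suc m) (suc k)) ∎
  where
  open ≈-Reasoning
  Q : PS
  Q = qpow (suc k)
  V : ℕ → ℕ → ℕ → PS
  V m k = vandermondeTerm m n k

-- Matching the two sides term by term

∸-≡ : ∀ {x} y z → y ℕ.+ z ≡ x → x ∸ y ≡ z
∸-≡ y z refl = ℕP.m+n∸m≡n y z

gaussℕ-qfac-≡ : ∀ {N} x y → x ℕ.+ y ≡ N → gaussℕ x y ≈ qfac N *ₚ qfacInv x *ₚ qfacInv y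
gaussℕ-qfac-≡ x y refl =
  ≈-trans (gaussℕ-qfac x y) (≈-reflexive (cong (λ z → qfac z *ₚ qfacInv x *ₚ qfacInv y) (ℕP.+-comm y x)))

qbinℕ-qfac : ∀ {N} x y → x ℕ.+ y ≡ N → qbinℕ N x ≈ qfac N *ₚ qfacInv x *ₚ qfacInv y
qbinℕ-qfac x y refl = ≈-trans (≈-reflexive (qbinℕ-+ x y)) (gaussℕ-qfac-≡ x y refl)

cancel-qfac² : ∀ a b Z → qfac a *ₚ qfacInv a *ₚ (qfac b *ₚ qfacInv b) *ₚ Z ≈ Z
cancel-qfac² a b Z = ≈-trans (*-cong (*ₚ-unitʳ _ (qfac-inverse b)) ≈-refl)
                             (≈-trans (*-cong (qfac-inverse a) ≈-refl) (*-identityˡ Z))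

Cbar-term : ℕ → ℕ → ℕ → PS
Cbar-term m k i = qpow (m ℕ.* (m ∸ i) ℕ.+ k ℕ.* k) *ₚ qbinℕ m i *ₚ qbinℕ i (2 ℕ.* k)

Cbar-Σ : ∀ m k → Cbar (+ m) k ≈ Σₚ[≤ m ] (Cbar-term m k)
Cbar-Σ m k = Σₚ-cong m (λ i _ → ≈-trans (⊛≈*ₚ _ _) (*-cong (⊛≈*ₚ _ _) ≈-refl))

Cbar-term-vanishes : ∀ m k {i} → i ℕ.< 2 ℕ.* k → Cbar-term m k i ≈ 0ₚ
Cbar-term-vanishes m k i<2k = *ₚ-zeroʳ _ (qbinℕ-> i<2k)

Cbar-vanishes : ∀ m k → m ℕ.< 2 ℕ.* k → Cbar (+ m) k ≈ 0ₚ
Cbar-vanishes m k m<2k = ≈-trans (Cbar-Σ m k) (Σₚ-zero m (λ i i≤m → Cbar-term-vanishes m k (ℕP.≤-<-trans i≤m m<2k)))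

doubleVandermondeTerm : ℕ → ℕ → ℕ → ℕ → PS
doubleVandermondeTerm m k r t = qpow ((m ∸ r) ℕ.* (k ∸ r)) *ₚ qbinℕ m r *ₚ vandermondeTerm r (m ∸ r) (k ∸ r) t

doubleVandermondeTerm-vanishes : ∀ m k {r t} → r ℕ.< t → doubleVandermondeTerm m k r t ≈ 0ₚ
doubleVandermondeTerm-vanishes m k r<t = *ₚ-zeroʳ _ (*ₚ-zeroˡ _ (*ₚ-zeroʳ _ (qbinℕ-> r<t)))

qbinℕ-double-vandermonde : ∀ m k → k ℕ.≤ m →
  qbinℕ (m ℕ.+ m) k ≈ Σₚ[≤ k ] (λ t → Σₚ[≤ k ∸ t ] (λ r → doubleVandermondeTerm m k r t))
qbinℕ-double-vandermonde m k k≤m = begin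
  qbinℕ (m ℕ.+ m) k                                              ≈⟨ qbinℕ-vandermonde m m k ⟩
  Σₚ[≤ k ] (vandermondeTerm m m k)                               ≈⟨ Σₚ-cong k (λ r r≤k → expand r (ℕP.≤-trans r≤k k≤m)) ⟩
  Σₚ[≤ k ] (λ r → Σₚ[≤ k ∸ r ] (doubleVandermondeTerm m k r))    ≈⟨ Σₚ-triangle-swap k (doubleVandermondeTerm m k) ⟩
  Σₚ[≤ k ] (λ t → Σₚ[≤ k ∸ t ] (λ r → doubleVandermondeTerm m k r t)) ∎
  where
  open ≈-Reasoning
  expand : ∀ r → r ℕ.≤ m → vandermondeTerm m m k r ≈ Σₚ[≤ k ∸ r ] (doubleVandermondeTerm m k r)
  expand r r≤m = ≈-trans (*-cong ≈-refl (≈-trans (≈-reflexive (cong (λ z → qbinℕ z (k ∸ r)) (sym (ℕP.m+[n∸m]≡n r≤m))))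
                                                 (qbinℕ-vandermonde r (m ∸ r) (k ∸ r))))
                         (Σₚ-*ₚˡ (k ∸ r) _ _)

-- Both sides of Cbar-term-⊛-central equal q^{α² + (2α+t+b)(t+b) + cb} [m]! / ([b]! [c]! [t]! [2α+t]!),
-- where m = 2α + 2t + c + b and [n]! is the q-factorial.
module _ (α t c b : ℕ) where
  private
    s P i r X k m : ℕ
    s = α ℕ.+ t
    P = α ℕ.+ t ℕ.+ α
    i = 2 ℕ.* s ℕ.+ c
    r = t ℕ.+ c
    X = P ℕ.+ b
    k = 2 ℕ.* t ℕ.+ (c ℕ.+ b)
    m = 2 ℕ.* α ℕ.+ k

    qmultinomial : PS
    qmultinomial = qfac m *ₚ qfacInv b *ₚ qfacInv c *ₚ qfacInv t *ₚ qfacInv P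

    i+b≡m : i ℕ.+ b ≡ m
    i+b≡m = lemma α t c b
      where
      lemma : ∀ α t c b → 2 ℕ.* (α ℕ.+ t) ℕ.+ c ℕ.+ b ≡ 2 ℕ.* α ℕ.+ (2 ℕ.* t ℕ.+ (c ℕ.+ b))
      lemma = ℕ-Solver.solve-∀

    t+P≡2s : t ℕ.+ P ≡ 2 ℕ.* s
    t+P≡2s = lemma α t
      where
      lemma : ∀ α t → t ℕ.+ (α ℕ.+ t ℕ.+ α) ≡ 2 ℕ.* (α ℕ.+ t)
      lemma = ℕ-Solver.solve-∀

    r+X≡m : r ℕ.+ X ≡ m
    r+X≡m = lemma α t c b
      where
      lemma : ∀ α t c b → t ℕ.+ c ℕ.+ (α ℕ.+ t ℕ.+ α ℕ.+ b) ≡ 2 ℕ.* α ℕ.+ (2 ℕ.* t ℕ.+ (c ℕ.+ b))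
      lemma = ℕ-Solver.solve-∀

    r+[t+b]≡k : r ℕ.+ (t ℕ.+ b) ≡ k
    r+[t+b]≡k = lemma t c b
      where
      lemma : ∀ t c b → t ℕ.+ c ℕ.+ (t ℕ.+ b) ≡ 2 ℕ.* t ℕ.+ (c ℕ.+ b)
      lemma = ℕ-Solver.solve-∀

    exponent : m ℕ.* b ℕ.+ s ℕ.* s ≡ α ℕ.* α ℕ.+ X ℕ.* (t ℕ.+ b) ℕ.+ c ℕ.* b
    exponent = lemma α t c b
      where
      lemma : ∀ α t c b → (2 ℕ.* α ℕ.+ (2 ℕ.* t ℕ.+ (c ℕ.+ b))) ℕ.* b ℕ.+ (α ℕ.+ t) ℕ.* (α ℕ.+ t)
                        ≡ α ℕ.* α ℕ.+ (α ℕ.+ t ℕ.+ α ℕ.+ b) ℕ.* (t ℕ.+ b) ℕ.+ c ℕ.* b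
      lemma = ℕ-Solver.solve-∀

    Cbar-term-⊛-central-qfac : Cbar-term m s i *ₚ gaussℕ t P ≈ qpow (m ℕ.* b ℕ.+ s ℕ.* s) *ₚ qmultinomial
    Cbar-term-⊛-central-qfac = begin
      Cbar-term m s i *ₚ gaussℕ t P
        ≈⟨ ≈-reflexive (cong (λ z → qpow (m ℕ.* z ℕ.+ s ℕ.* s) *ₚ qbinℕ m i *ₚ qbinℕ i (2 ℕ.* s) *ₚ gaussℕ t P) (∸-≡ i b i+b≡m)) ⟩
      qpow E *ₚ qbinℕ m i *ₚ qbinℕ i (2 ℕ.* s) *ₚ gaussℕ t P
        ≈⟨ *-cong (*-cong (*-cong ≈-refl (qbinℕ-qfac i b i+b≡m)) (qbinℕ-qfac (2 ℕ.* s) c refl)) (gaussℕ-qfac-≡ t P t+P≡2s) ⟩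
      qpow E *ₚ (F m *ₚ I i *ₚ I b) *ₚ (F i *ₚ I (2 ℕ.* s) *ₚ I c) *ₚ (F (2 ℕ.* s) *ₚ I t *ₚ I P)
        ≈⟨ solve 10 (λ e fm ii ib fi i2 ic f2 it ip →
              e :* (fm :* ii :* ib) :* (fi :* i2 :* ic) :* (f2 :* it :* ip) :=
              fi :* ii :* (f2 :* i2) :* (e :* (fm :* ib :* ic :* it :* ip)))
            ≈-refl (qpow E) (F m) (I i) (I b) (F i) (I (2 ℕ.* s)) (I c) (F (2 ℕ.* s)) (I t) (I P) ⟩
      F i *ₚ I i *ₚ (F (2 ℕ.* s) *ₚ I (2 ℕ.* s)) *ₚ (qpow E *ₚ qmultinomial)
        ≈⟨ cancel-qfac² i (2 ℕ.* s) _ ⟩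
      qpow E *ₚ qmultinomial ∎
      where
      open ≈-Reasoning
      F I : ℕ → PS
      F = qfac
      I = qfacInv
      E : ℕ
      E = m ℕ.* b ℕ.+ s ℕ.* s

    doubleVandermondeTerm-qfac :
      qpow (α ℕ.* α) *ₚ doubleVandermondeTerm m k r t ≈ qpow (α ℕ.* α ℕ.+ X ℕ.* (t ℕ.+ b) ℕ.+ c ℕ.* b) *ₚ qmultinomial
    doubleVandermondeTerm-qfac = begin
      qpow A *ₚ doubleVandermondeTerm m k r t
        ≈⟨ *-cong ≈-refl (≈-reflexive indices) ⟩
      qpow A *ₚ (qpow B *ₚ qbinℕ m r *ₚ (qpow C *ₚ qbinℕ r t *ₚ qbinℕ X b))
        ≈⟨ *-cong ≈-refl (*-cong (*-cong ≈-refl (qbinℕ-qfac r X r+X≡m))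
                                 (*-cong (*-cong ≈-refl (qbinℕ-qfac t c refl)) (qbinℕ-qfac b P (ℕP.+-comm b P)))) ⟩
      qpow A *ₚ (qpow B *ₚ (F m *ₚ I r *ₚ I X) *ₚ (qpow C *ₚ (F r *ₚ I t *ₚ I c) *ₚ (F X *ₚ I b *ₚ I P)))
        ≈⟨ solve 12 (λ fr ir fx ix qa qb qc fm ib ic it ip →
              qa :* (qb :* (fm :* ir :* ix) :* (qc :* (fr :* it :* ic) :* (fx :* ib :* ip))) :=
              fr :* ir :* (fx :* ix) :* (qa :* qb :* qc :* (fm :* ib :* ic :* it :* ip)))
            ≈-refl (F r) (I r) (F X) (I X) (qpow A) (qpow B) (qpow C) (F m) (I b) (I c) (I t) (I P) ⟩
      F r *ₚ I r *ₚ (F X *ₚ I X) *ₚ (qpow A *ₚ qpow B *ₚ qpow C *ₚ qmultinomial)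
        ≈⟨ cancel-qfac² r X _ ⟩
      qpow A *ₚ qpow B *ₚ qpow C *ₚ qmultinomial
        ≈⟨ *-cong (≈-trans (*-cong (qpow-*ₚ-qpow A B) ≈-refl) (qpow-*ₚ-qpow (A ℕ.+ B) C)) ≈-refl ⟩
      qpow (A ℕ.+ B ℕ.+ C) *ₚ qmultinomial ∎
      where
      open ≈-Reasoning
      F I : ℕ → PS
      F = qfac
      I = qfacInv
      A B C : ℕ
      A = α ℕ.* α
      B = X ℕ.* (t ℕ.+ b)
      C = c ℕ.* b
      indices : doubleVandermondeTerm m k r t ≡ qpow B *ₚ qbinℕ m r *ₚ (qpow C *ₚ qbinℕ r t *ₚ qbinℕ X b)
      indices rewrite ∸-≡ r X r+X≡m | ∸-≡ r (t ℕ.+ b) r+[t+b]≡k | ℕP.m+n∸m≡n t b | ℕP.m+n∸m≡n t c = refl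

  Cbar-term-⊛-central : ∀ {m′ k′} → 2 ℕ.* α ℕ.+ k′ ≡ m′ → 2 ℕ.* t ℕ.+ (c ℕ.+ b) ≡ k′ →
    Cbar-term m′ (α ℕ.+ t) (2 ℕ.* (α ℕ.+ t) ℕ.+ c) *ₚ gaussℕ t (α ℕ.+ t ℕ.+ α)
      ≈ qpow (α ℕ.* α) *ₚ doubleVandermondeTerm m′ k′ (t ℕ.+ c) t
  Cbar-term-⊛-central refl refl =
    ≈-trans Cbar-term-⊛-central-qfac
            (≈-trans (*-cong (≈-reflexive (cong qpow exponent)) ≈-refl) (≈-sym doubleVandermondeTerm-qfac))

central-below : ∀ α {k} → k ℕ.< α → qbin (+ (2 ℕ.* k)) (+ k - + α) ≈ 0ₚ
central-below α {k} k<α with ℕP.m≤n⇒∃[o]m+o≡n k<α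
... | r , refl = ≈-reflexive (cong (λ z → qbin (+ (2 ℕ.* k)) z) (pos-minus-larger k r))

central-shift : ∀ α t → qbin (+ (2 ℕ.* (α ℕ.+ t))) (+ (α ℕ.+ t) - + α) ≡ gaussℕ t (α ℕ.+ t ℕ.+ α)
central-shift α t rewrite pos-+-minus α t = cong (gaussℤ (+ t))
  (trans (cong (λ z → + z - + t) (lemma α t)) (pos-+-minus t (α ℕ.+ t ℕ.+ α)))
  where
  lemma : ∀ α t → 2 ℕ.* (α ℕ.+ t) ≡ t ℕ.+ (α ℕ.+ t ℕ.+ α)
  lemma = ℕ-Solver.solve-∀

2*-<-+ : ∀ α {k t} → k ℕ.< 2 ℕ.* t → 2 ℕ.* α ℕ.+ k ℕ.< 2 ℕ.* (α ℕ.+ t)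
2*-<-+ α {k} {t} k<2t = subst (2 ℕ.* α ℕ.+ k ℕ.<_) (sym (ℕP.*-distribˡ-+ 2 α t)) (ℕP.+-monoʳ-< (2 ℕ.* α) k<2t)

Cbar-⊛-central : ∀ α t {m k} → 2 ℕ.* α ℕ.+ k ≡ m → t ℕ.≤ k →
  Cbar (+ m) (α ℕ.+ t) *ₚ gaussℕ t (α ℕ.+ t ℕ.+ α)
    ≈ qpow (α ℕ.* α) *ₚ Σₚ[≤ k ∸ t ] (λ r → doubleVandermondeTerm m k r t)
Cbar-⊛-central α t {k = k} refl t≤k with ℕP.<-≤-connex k (2 ℕ.* t)
... | inj₁ k<2t = ≈-trans (*ₚ-zeroˡ _ (Cbar-vanishes _ (α ℕ.+ t) (2*-<-+ α k<2t)))
                         (≈-sym (*ₚ-zeroʳ _ (Σₚ-zero (k ∸ t) (λ r r≤k∸t → doubleVandermondeTerm-vanishes _ k (r<t r r≤k∸t)))))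
  where
  r<t : ∀ r → r ℕ.≤ k ∸ t → r ℕ.< t
  r<t r r≤k∸t = ℕP.+-cancelʳ-< t r t (ℕP.≤-<-trans (ℕP.m≤o∸n⇒m+n≤o r t≤k r≤k∸t)
                                                   (subst (k ℕ.<_) (cong (t ℕ.+_) (ℕP.+-identityʳ t)) k<2t))
... | inj₂ 2t≤k with ℕP.m≤n⇒∃[o]m+o≡n 2t≤k
...   | e , refl = begin
  Cbar (+ m) s *ₚ G                                      ≈⟨ *-cong (Cbar-Σ m s) ≈-refl ⟩
  Σₚ[≤ m ] (Cbar-term m s) *ₚ G                          ≈⟨ *-cong (≈-reflexive (cong (λ z → Σₚ[≤ z ] (Cbar-term m s)) m≡2s+e)) ≈-refl ⟩
  Σₚ[≤ 2 ℕ.* s ℕ.+ e ] (Cbar-term m s) *ₚ G              ≈⟨ *-cong (Σₚ-dropˡ (2 ℕ.* s) e _ (λ i i<2s → Cbar-term-vanishes m s i<2s)) ≈-refl ⟩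
  Σₚ[≤ e ] (λ c → Cbar-term m s (2 ℕ.* s ℕ.+ c)) *ₚ G    ≈⟨ Σₚ-*ₚʳ e G _ ⟩
  Σₚ[≤ e ] (λ c → Cbar-term m s (2 ℕ.* s ℕ.+ c) *ₚ G)    ≈⟨ Σₚ-cong e (λ c c≤e → Cbar-term-⊛-central α t c (e ∸ c) refl
                                                               (cong (2 ℕ.* t ℕ.+_) (ℕP.m+[n∸m]≡n c≤e))) ⟩
  Σₚ[≤ e ] (λ c → qpow (α ℕ.* α) *ₚ Ψ (t ℕ.+ c))         ≈⟨ ≈-sym (Σₚ-*ₚˡ e _ _) ⟩
  qpow (α ℕ.* α) *ₚ Σₚ[≤ e ] (λ c → Ψ (t ℕ.+ c))         ≈⟨ *-cong ≈-refl (≈-sym (Σₚ-dropˡ t e Ψ (λ r r<t → doubleVandermondeTerm-vanishes m k r<t))) ⟩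
  qpow (α ℕ.* α) *ₚ Σₚ[≤ t ℕ.+ e ] Ψ                     ≈⟨ *-cong ≈-refl (≈-reflexive (cong (λ z → Σₚ[≤ z ] Ψ) (sym k∸t≡t+e))) ⟩
  qpow (α ℕ.* α) *ₚ Σₚ[≤ k ∸ t ] Ψ                       ∎
  where
  open ≈-Reasoning
  s m : ℕ
  s = α ℕ.+ t
  m = 2 ℕ.* α ℕ.+ k
  G : PS
  G = gaussℕ t (α ℕ.+ t ℕ.+ α)
  Ψ : ℕ → PS
  Ψ r = doubleVandermondeTerm m k r t
  m≡2s+e : m ≡ 2 ℕ.* s ℕ.+ e
  m≡2s+e = lemma α t e
    where
    lemma : ∀ α t e → 2 ℕ.* α ℕ.+ (2 ℕ.* t ℕ.+ e) ≡ 2 ℕ.* (α ℕ.+ t) ℕ.+ e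
    lemma = ℕ-Solver.solve-∀
  k∸t≡t+e : k ∸ t ≡ t ℕ.+ e
  k∸t≡t+e = ∸-≡ t (t ℕ.+ e) (lemma t e)
    where
    lemma : ∀ t e → t ℕ.+ (t ℕ.+ e) ≡ 2 ℕ.* t ℕ.+ e
    lemma = ℕ-Solver.solve-∀

lhs : ℤ → ℤ → ℕ → PS
lhs M a K = Σₚ[≤ K ] (λ k → Cbar M k ⊛ qbin (+ (2 ℕ.* k)) (+ k - a))

rhs : ℤ → ℤ → PS
rhs M a = qpow (∣ a ∣ ℕ.* ∣ a ∣) ⊛ qbin (+ 2 * M) (M - + 2 * a)

rhs-*ₚ : ∀ M a → rhs M a ≈ qpow (∣ a ∣ ℕ.* ∣ a ∣) *ₚ qbin (+ 2 * M) (M - + 2 * a)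
rhs-*ₚ M a = ⊛≈*ₚ _ _

lhs-shift : ∀ m α K → α ℕ.≤ K →
  lhs (+ m) (+ α) K ≈ Σₚ[≤ K ∸ α ] (λ t → Cbar (+ m) (α ℕ.+ t) *ₚ gaussℕ t (α ℕ.+ t ℕ.+ α))
lhs-shift m α K α≤K = begin
  lhs (+ m) (+ α) K                                   ≈⟨ Σₚ-cong K (λ k _ → ⊛≈*ₚ _ _) ⟩
  Σₚ[≤ K ] T                                          ≈⟨ ≈-reflexive (cong (λ z → Σₚ[≤ z ] T) (sym (ℕP.m+[n∸m]≡n α≤K))) ⟩
  Σₚ[≤ α ℕ.+ (K ∸ α) ] T                              ≈⟨ Σₚ-dropˡ α (K ∸ α) T (λ k k<α → *ₚ-zeroʳ _ (central-below α k<α)) ⟩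
  Σₚ[≤ K ∸ α ] (λ t → T (α ℕ.+ t))                    ≈⟨ Σₚ-cong (K ∸ α) (λ t _ → *-cong ≈-refl (≈-reflexive (central-shift α t))) ⟩
  Σₚ[≤ K ∸ α ] (λ t → Cbar (+ m) (α ℕ.+ t) *ₚ gaussℕ t (α ℕ.+ t ℕ.+ α)) ∎
  where
  open ≈-Reasoning
  T : ℕ → PS
  T k = Cbar (+ m) k *ₚ qbin (+ (2 ℕ.* k)) (+ k - + α)

rhs-≥ : ∀ α k {m} → 2 ℕ.* α ℕ.+ k ≡ m → qbin (+ 2 * + m) (+ m - + 2 * + α) ≡ qbinℕ (m ℕ.+ m) k
rhs-≥ α k refl = cong₂ qbin (trans (double (+ m)) (sym (ℤP.pos-+ m m)))
                            (trans (cong (λ z → + m - z) (sym (ℤP.pos-* 2 α))) (pos-+-minus (2 ℕ.* α) k))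
  where
  m : ℕ
  m = 2 ℕ.* α ℕ.+ k
  double : ∀ x → + 2 * x ≡ x + x
  double = ℤ-Solver.solve-∀

rhs-< : ∀ α {m} → m ℕ.< 2 ℕ.* α → qbin (+ 2 * + m) (+ m - + 2 * + α) ≈ 0ₚ
rhs-< α {m} m<2α with ℕP.m≤n⇒∃[o]m+o≡n m<2α
... | r , 1+m+r≡2α = ≈-reflexive (cong (qbin (+ 2 * + m))
  (trans (cong (λ z → + m - z) (trans (sym (ℤP.pos-* 2 α)) (cong +_ (sym 1+m+r≡2α)))) (pos-minus-larger m r)))

identity-pos : ∀ m α → ∃[ N ] (∀ K → N ℕ.≤ K → lhs (+ m) (+ α) K ≈ rhs (+ m) (+ α))
identity-pos m α = α ℕ.+ m , λ K α+m≤K → ≈-trans (lhs-shift m α K (ℕP.≤-trans (ℕP.m≤m+n α m) α+m≤K)) (sum≈rhs K α+m≤K)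
  where
  sum≈rhs : ∀ K → α ℕ.+ m ℕ.≤ K →
    Σₚ[≤ K ∸ α ] (λ t → Cbar (+ m) (α ℕ.+ t) *ₚ gaussℕ t (α ℕ.+ t ℕ.+ α)) ≈ rhs (+ m) (+ α)
  sum≈rhs K α+m≤K with ℕP.<-≤-connex m (2 ℕ.* α)
  ... | inj₁ m<2α = ≈-trans (Σₚ-zero (K ∸ α) (λ t _ → *ₚ-zeroˡ _ (Cbar-vanishes m (α ℕ.+ t)
                                (ℕP.<-≤-trans m<2α (ℕP.*-monoʳ-≤ 2 (ℕP.m≤m+n α t))))))
                            (≈-sym (≈-trans (rhs-*ₚ (+ m) (+ α)) (*ₚ-zeroʳ _ (rhs-< α m<2α))))
  ... | inj₂ 2α≤m with ℕP.m≤n⇒∃[o]m+o≡n 2α≤m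
  ...   | k , 2α+k≡m = begin
    Σₚ[≤ K ∸ α ] T                                      ≈⟨ Σₚ-extend k (K ∸ α) T k≤K∸α (λ t k<t _ → beyond t k<t) ⟩
    Σₚ[≤ k ] T                                          ≈⟨ Σₚ-cong k (λ t t≤k → Cbar-⊛-central α t 2α+k≡m t≤k) ⟩
    Σₚ[≤ k ] (λ t → qpow (α ℕ.* α) *ₚ Σₚ[≤ k ∸ t ] (λ r → doubleVandermondeTerm m k r t))
                                                        ≈⟨ ≈-sym (Σₚ-*ₚˡ k _ _) ⟩
    qpow (α ℕ.* α) *ₚ Σₚ[≤ k ] (λ t → Σₚ[≤ k ∸ t ] (λ r → doubleVandermondeTerm m k r t))
                                                        ≈⟨ *-cong ≈-refl (≈-sym (qbinℕ-double-vandermonde m k k≤m)) ⟩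
    qpow (α ℕ.* α) *ₚ qbinℕ (m ℕ.+ m) k                 ≈⟨ ≈-sym (≈-trans (rhs-*ₚ (+ m) (+ α)) (*-cong ≈-refl (≈-reflexive (rhs-≥ α k 2α+k≡m)))) ⟩
    rhs (+ m) (+ α)                                     ∎
    where
    open ≈-Reasoning
    T : ℕ → PS
    T t = Cbar (+ m) (α ℕ.+ t) *ₚ gaussℕ t (α ℕ.+ t ℕ.+ α)
    beyond : ∀ t → k ℕ.< t → T t ≈ 0ₚ
    beyond t k<t = *ₚ-zeroˡ _ (Cbar-vanishes m (α ℕ.+ t)
      (subst (ℕ._< 2 ℕ.* (α ℕ.+ t)) 2α+k≡m (2*-<-+ α (ℕP.<-≤-trans k<t (ℕP.m≤m+n t (t ℕ.+ 0))))))
    k≤m : k ℕ.≤ m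
    k≤m = subst (k ℕ.≤_) 2α+k≡m (ℕP.m≤n+m k (2 ℕ.* α))
    k≤K∸α : k ℕ.≤ K ∸ α
    k≤K∸α = ℕP.≤-trans k≤m (ℕP.m+n≤o⇒m≤o∸n m (subst (ℕ._≤ K) (ℕP.+-comm α m) α+m≤K))

lhs-neg : ∀ M a K → lhs M a K ≈ lhs M (- a) K
lhs-neg M a K = Σₚ-cong K λ k _ → ⊛-congʳ (Cbar M k) (≈-trans (qbin-reflect (+ (2 ℕ.* k)) (+ k - a))
  (≈-reflexive (cong (qbin (+ (2 ℕ.* k))) (trans (cong (λ z → z - (+ k - a)) (double k)) (reflect (+ k) a)))))
  where
  double : ∀ k → + (2 ℕ.* k) ≡ + k + + k
  double k = trans (cong (λ z → + (k ℕ.+ z)) (ℕP.+-identityʳ k)) (ℤP.pos-+ k k)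
  reflect : ∀ K a → K + K - (K - a) ≡ K - - a
  reflect = ℤ-Solver.solve-∀

rhs-neg : ∀ M a → rhs M a ≈ rhs M (- a)
rhs-neg M a = ≈-trans
  (⊛-congʳ (qpow (∣ a ∣ ℕ.* ∣ a ∣)) (≈-trans (qbin-reflect (+ 2 * M) (M - + 2 * a)) (≈-reflexive (cong (qbin (+ 2 * M)) (reflect M a)))))
  (≈-reflexive (cong (λ n → qpow (n ℕ.* n) ⊛ qbin (+ 2 * M) (M - + 2 * - a)) (sym (ℤP.∣-i∣≡∣i∣ a))))
  where
  reflect : ∀ M a → + 2 * M - (M - + 2 * a) ≡ M - + 2 * - a
  reflect = ℤ-Solver.solve-∀

identity : ∀ M a → ∃[ N ] (∀ K → N ℕ.≤ K → lhs M a K ≈ rhs M a)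
identity (+ m)    (+ α)    = identity-pos m α
identity (+ m)    -[1+ n ] with identity-pos m (suc n)
... | N , lhs≈rhs = N , λ K N≤K →
  ≈-trans (lhs-neg (+ m) -[1+ n ] K) (≈-trans (lhs≈rhs K N≤K) (≈-sym (rhs-neg (+ m) -[1+ n ])))
identity -[1+ m ] a = 0 , λ K _ → ≈-trans (lhs≈0 K) (≈-sym rhs≈0)
  where
  lhs≈0 : ∀ K → lhs -[1+ m ] a K ≈ 0ₚ
  lhs≈0 K = Σₚ-zero K (λ k _ → mk≈ λ d → sumℤ-zero d (λ _ _ → refl))
  rhs≈0 : rhs -[1+ m ] a ≈ 0ₚ
  rhs≈0 = ≈-trans (rhs-*ₚ -[1+ m ] a) (*ₚ-zeroʳ _ (gaussℤ-negative B (A - B) (cancel A B)))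
    where
    A B : ℤ
    A = + 2 * -[1+ m ]
    B = -[1+ m ] - + 2 * a
    cancel : ∀ A B → B + (A - B) ≡ A
    cancel = ℤ-Solver.solve-∀

corollary2p2 : (M a : ℤ) →
    ((k d : ℕ) → + 0 ≤ Cbar M k d)
    × ((d : ℕ) → ∃[ N ] ((K : ℕ) → N ℕ.≤ K →
        Σₚ[≤ K ] (λ k → Cbar M k ⊛ qbin (+ (2 ℕ.* k)) (+ k - a)) d
          ≡ (qpow (∣ a ∣ ℕ.* ∣ a ∣) ⊛ qbin (+ 2 * M) (M - + 2 * a)) d))
corollary2p2 M a = nonNeg-Cbar M , λ d →
  let N , lhs≈rhs = identity M a in N , λ K N≤K → at (lhs≈rhs K N≤K) d
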